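{- Let $\mathbf{5}$ be the set of all formulas of the form $\neg\mathrm{K}\varphi\rightarrow\mathrm{K}\neg\mathrm{K}\varphi$. No theory containing $\mathbf{5}$ as a subset is closed generic.
   Context: Fix a nonempty set of symbols called propositional atoms and a symbol $\mathrm{K}$ which is not a propositional atom. Formulas are defined recursively: every propositional atom is a formula; if $\varphi,\psi$ are formulas then so are $\neg\varphi$, $(\varphi\wedge\psi)$, $(\varphi\vee\psi)$, $(\varphi\rightarrow\psi)$; if $\varphi$ is a formula then so is $\mathrm{K}(\varphi)$. A formula is basic if it is a propositional atom or of the form $\mathrm{K}\varphi$. A theory is a set of formulas. A model is a function assigning a truth value to every basic formula; truth $\mathscr M\models\varphi$ of an arbitrary formula is defined from the values of basic formulas by the classical truth tables (formulas $\mathrm{K}\varphi$ are treated like atoms). $\mathscr M\models T$ means $\mathscr M\models\varphi$ for all $\varphi\in T$; $T\models\varphi$ means every model of $T$ satisfies $\varphi$. A theory $T$ is closed if $\varphi\in T$ implies $\mathrm{K}\varphi\in T$. For a theory $T$ and a set $S$ of propositional atoms, $\mathscr M_{T,S}$ is the model with $\mathscr M_{T,S}\models p$ iff $p\in S$ for atoms $p$, and $\mathscr M_{T,S}\models\mathrm{K}\varphi$ iff $T\models\varphi$. A theory $T$ is closed generic if for every set $S$ of propositional atoms and every closed theory $T'\supseteq T$, $\mathscr M_{T',S}\models T$. -}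

module Defs where

open import Data.Bool using (Bool; true; false; not; _∧_; _∨_; if_then_else_)
open import Data.Product using (_×_; _,_)
open import Relation.Binary.PropositionalEquality using (_≡_)
open import Relation.Unary using (Pred; _⊆_)
open import Function.Bundles using (_⇔_)
open import Level using (0ℓ)

data Formula (A : Set) : Set where
  atom : A → Formula A
  ¬'_  : Formula A → Formula A
  _∧'_ : Formula A → Formula A → Formula A
  _∨'_ : Formula A → Formula A → Formula A
  _→'_ : Formula A → Formula A → Formula A
  K    : Formula A → Formula A

data Basic (A : Set) : Set where
  batom : A → Basic A
  bK    : Formula A → Basic A

Model : Set → Set
Model A = Basic A → Bool

_⇒ᵇ_ : Bool → Bool → Bool
a ⇒ᵇ b = not a ∨ b

eval : {A : Set} → Model A → Formula A → Bool
eval M (atom p) = M (batom p)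
eval M (¬' φ)   = not (eval M φ)
eval M (φ ∧' ψ) = eval M φ ∧ eval M ψ
eval M (φ ∨' ψ) = eval M φ ∨ eval M ψ
eval M (φ →' ψ) = eval M φ ⇒ᵇ eval M ψ
eval M (K φ)    = M (bK φ)

Theory : Set → Set₁
Theory A = Pred (Formula A) 0ℓ

_⊨_ : {A : Set} → Model A → Formula A → Set
M ⊨ φ = eval M φ ≡ true

_⊨T_ : {A : Set} → Model A → Theory A → Set
M ⊨T T = ∀ φ → T φ → M ⊨ φ

_⊩_ : {A : Set} → Theory A → Formula A → Set
T ⊩ φ = ∀ (M : Model _) → M ⊨T T → M ⊨ φ

Closed : {A : Set} → Theory A → Set
Closed T = ∀ φ → T φ → T (K φ)

-- M is the model M_{T,S}: atoms true exactly on S, K φ true iff T ⊨ φ.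
-- (Stated relationally; classically there is exactly one such model.)
IsMTS : {A : Set} → Theory A → Pred A 0ℓ → Model A → Set
IsMTS T S M = (∀ p → (M (batom p) ≡ true) ⇔ S p)
            × (∀ φ → (M (bK φ) ≡ true) ⇔ (T ⊩ φ))

ClosedGeneric : {A : Set} → Theory A → Set₁
ClosedGeneric {A} T =
  ∀ (S : Pred A 0ℓ) (T' : Theory A) → Closed T' → T ⊆ T' →
  ∀ (M : Model A) → IsMTS T' S M → M ⊨T T

data Five {A : Set} : Formula A → Set where
  five : ∀ φ → Five ((¬' K φ) →' K (¬' K φ))

{-# OPTIONS --safe #-}
module Submission where

-- Let Γ be the K-closure of T and Δ that of T ∪ {a} for an atom a. Genericity of T
-- makes M_{Γ,∅} a model of Γ in which a fails, so Γ ⊭ a; the instance ¬Ka → K¬Ka of 5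
-- then forces Γ ⊨ ¬Ka. On the other hand M_{Δ,A} is a model of Δ ⊇ Γ with Δ ⊨ a, so it
-- satisfies both Ka and ¬Ka.

open import Defs
open import Axiom.ExcludedMiddle using (ExcludedMiddle)
open import Relation.Nullary using (¬_; Dec; yes; no; does)
open import Relation.Unary using (Pred; _⊆_; _∪_; ｛_｝; ∅; U)
open import Level using (0ℓ)
open import Data.Bool using (true; false)
open import Data.Product using (_,_; proj₁; proj₂)
open import Data.Sum using (inj₁; inj₂)
open import Data.Empty using (⊥-elim)
open import Relation.Binary.PropositionalEquality using (_≡_; refl)
open import Function using (_∘_)
open import Function.Bundles using (_⇔_; mk⇔; Equivalence)

private
  variable
    A : Set

data Closure (Γ : Theory A) : Theory A where
  base : ∀ {φ} → Γ φ → Closure Γ φ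
  step : ∀ {φ} → Closure Γ φ → Closure Γ (K φ)

Closure-closed : (Γ : Theory A) → Closed (Closure Γ)
Closure-closed Γ φ = step

Closure-mono : {Γ Δ : Theory A} → Γ ⊆ Δ → Closure Γ ⊆ Closure Δ
Closure-mono Γ⊆Δ (base φ∈Γ) = base (Γ⊆Δ φ∈Γ)
Closure-mono Γ⊆Δ (step φ∈Γ) = step (Closure-mono Γ⊆Δ φ∈Γ)

⊩-member : (Γ : Theory A) {φ : Formula A} → Γ φ → Γ ⊩ φ
⊩-member Γ φ∈Γ M M⊨Γ = M⊨Γ _ φ∈Γ

does-true⇔ : {P : Set} (P? : Dec P) → (does P? ≡ true) ⇔ P
does-true⇔ (yes p) = mk⇔ (λ _ → p) (λ _ → refl)
does-true⇔ (no ¬p) = mk⇔ (λ ()) (λ p → ⊥-elim (¬p p))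

MTS : ExcludedMiddle 0ℓ → Theory A → Pred A 0ℓ → Model A
MTS em Γ S (batom p) = does (em {S p})
MTS em Γ S (bK φ)    = does (em {Γ ⊩ φ})

MTS-isMTS : (em : ExcludedMiddle 0ℓ) (Γ : Theory A) (S : Pred A 0ℓ) → IsMTS Γ S (MTS em Γ S)
MTS-isMTS em Γ S = (λ p → does-true⇔ em) , (λ φ → does-true⇔ em)

⊨¬-intro : (M : Model A) (φ : Formula A) → eval M φ ≡ false → M ⊨ (¬' φ)
⊨¬-intro M φ M⊭φ rewrite M⊭φ = refl

⊨-mp : (M : Model A) (φ ψ : Formula A) → M ⊨ (φ →' ψ) → M ⊨ φ → M ⊨ ψ
⊨-mp M φ ψ M⊨φ→ψ M⊨φ rewrite M⊨φ = M⊨φ→ψ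

⊨¬⇒⊭ : (M : Model A) (φ : Formula A) → M ⊨ (¬' φ) → ¬ (M ⊨ φ)
⊨¬⇒⊭ M φ M⊨¬φ M⊨φ with eval M φ
⊨¬⇒⊭ M φ () refl | true

module _ {Γ : Theory A} {S : Pred A 0ℓ} (M : Model A) (mts : IsMTS Γ S M) where

  private
    K-true⇔ : ∀ φ → (M (bK φ) ≡ true) ⇔ (Γ ⊩ φ)
    K-true⇔ φ = proj₂ mts φ

  MTS-⊨K : ∀ φ → Γ ⊩ φ → M ⊨ K φ
  MTS-⊨K φ = Equivalence.from (K-true⇔ φ)

  MTS-K-false : ∀ {φ} → ¬ (Γ ⊩ φ) → M (bK φ) ≡ false
  MTS-K-false {φ} Γ⊮φ with M (bK φ) in eq
  ... | false = refl
  ... | true  = ⊥-elim (Γ⊮φ (Equivalence.to (K-true⇔ φ) eq))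

  MTS-⊨atom : ∀ {p} → M ⊨ atom p → S p
  MTS-⊨atom {p} = Equivalence.to (proj₁ mts p)

  module _ (M⊨Γ : M ⊨T Γ) where

    MTS-⊮atom : ∀ {p} → ¬ S p → ¬ (Γ ⊩ atom p)
    MTS-⊮atom ¬Sp Γ⊩p = ¬Sp (MTS-⊨atom (Γ⊩p M M⊨Γ))

    five-⊩¬K : Five ⊆ Γ → ∀ {φ} → ¬ (Γ ⊩ φ) → Γ ⊩ (¬' K φ)
    five-⊩¬K Five⊆Γ {φ} Γ⊮φ =
      Equivalence.to (K-true⇔ (¬' K φ))
        (⊨-mp M (¬' K φ) (K (¬' K φ)) (M⊨Γ _ (Five⊆Γ (five φ)))
          (⊨¬-intro M (K φ) (MTS-K-false Γ⊮φ)))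

MTS-⊨Closure : {Γ : Theory A} {S : Pred A 0ℓ} (M : Model A) →
  IsMTS (Closure Γ) S M → M ⊨T Γ → M ⊨T Closure Γ
MTS-⊨Closure M mts M⊨Γ φ     (base φ∈Γ) = M⊨Γ φ φ∈Γ
MTS-⊨Closure M mts M⊨Γ (K φ) (step φ∈Γ) = MTS-⊨K M mts φ (⊩-member (Closure _) φ∈Γ)

generic-⊨Closure : {T : Theory A} → ClosedGeneric T → (Δ : Theory A) →
  ∀ {S} (M : Model A) → IsMTS (Closure (T ∪ Δ)) S M → M ⊨T Δ → M ⊨T Closure (T ∪ Δ)
generic-⊨Closure {T = T} generic Δ {S} M mts M⊨Δ = MTS-⊨Closure M mts M⊨T∪Δ
  where
  M⊨T∪Δ : M ⊨T (T ∪ Δ)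
  M⊨T∪Δ φ (inj₁ φ∈T) = generic S (Closure (T ∪ Δ)) (Closure-closed _) (base ∘ inj₁) M mts φ φ∈T
  M⊨T∪Δ φ (inj₂ φ∈Δ) = M⊨Δ φ φ∈Δ

theorem28 : ExcludedMiddle 0ℓ → {A : Set} → A →
    (T : Theory A) → Five ⊆ T → ¬ ClosedGeneric T
theorem28 em {A} a T Five⊆T generic = ⊨¬⇒⊭ M₂ (K (atom a)) M₂⊨¬Ka M₂⊨Ka
  where
  Γ Δ : Theory A
  Γ = Closure (T ∪ ∅)
  Δ = Closure (T ∪ ｛ atom a ｝)

  M₁ M₂ : Model A
  M₁ = MTS em Γ ∅
  M₂ = MTS em Δ U

  mts₁ : IsMTS Γ ∅ M₁
  mts₁ = MTS-isMTS em Γ ∅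
  mts₂ : IsMTS Δ U M₂
  mts₂ = MTS-isMTS em Δ U

  M₁⊨Γ : M₁ ⊨T Γ
  M₁⊨Γ = generic-⊨Closure generic ∅ M₁ mts₁ λ _ ()

  Γ⊩¬Ka : Γ ⊩ (¬' K (atom a))
  Γ⊩¬Ka = five-⊩¬K M₁ mts₁ M₁⊨Γ (base ∘ inj₁ ∘ Five⊆T) (MTS-⊮atom M₁ mts₁ M₁⊨Γ λ ())

  M₂⊨Δ : M₂ ⊨T Δ
  M₂⊨Δ = generic-⊨Closure generic ｛ atom a ｝ M₂ mts₂
           λ where _ refl → Equivalence.from (proj₁ mts₂ a) _

  M₂⊨¬Ka : M₂ ⊨ (¬' K (atom a))
  M₂⊨¬Ka = Γ⊩¬Ka M₂ λ φ φ∈Γ → M₂⊨Δ φ (Closure-mono (λ where (inj₁ φ∈T) → inj₁ φ∈T) φ∈Γ)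

  M₂⊨Ka : M₂ ⊨ K (atom a)
  M₂⊨Ka = MTS-⊨K M₂ mts₂ (atom a) (⊩-member Δ (base (inj₂ refl)))
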